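{- For any $k\ge0$, $\mathcal{B}(k)$ is a simplicial complex on vertex set $[k-1]=\{1,\dots,k-1\}$, of dimension $\lfloor k/2\rfloor-1$, and its $f$-vector $(f_0,f_1,\dots,f_{\lfloor k/2\rfloor})$ is given by $f_i(\mathcal{B}(k))=\binom{k}{i}-\binom{k}{i-1}$.
   Context: A ballot path of length $k$ is a word $p=p_1\cdots p_k$ in the letters $N$ (north step $(0,1)$) and $E$ (east step $(1,0)$) such that every initial subword contains at least as many $E$'s as $N$'s (the lattice path from $(0,0)$ never goes above the line $y=x$). $B(k)$ is the set of ballot paths of length $k$; for $p\in B(k)$, $S(p)=\{k+1-i:p_i=N\}$; and $\mathcal{B}(k)=\{S(p):p\in B(k)\}$. The $f$-vector has $f_i$ equal to the number of faces with $i$ elements, $f_0=1$ for the empty face; $\binom{k}{ -1}=0$. -}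

module Defs where

open import Data.Nat using (ℕ; zero; suc; _+_; _≤_; _∸_; _/_)
open import Data.Nat.Combinatorics using (_C_)
open import Data.Bool using (Bool; true; false)
open import Data.List using (List; []; _∷_; inits)
open import Data.List.Relation.Unary.All using (All)
open import Data.Vec using (Vec; lookup; tabulate; toList)
open import Data.Fin using (Fin; toℕ; opposite)
open import Data.Fin.Subset using (Subset; _⊆_; _∈_; ∣_∣; ⁅_⁆; inside; outside)
open import Data.Product using (Σ; ∃; _×_)
open import Relation.Binary.PropositionalEquality using (_≡_)
open import Function.Bundles using (_↔_)

-- Letters of a lattice word: north step (0,1) and east step (1,0).
data Step : Set where
  N E : Step

#N : List Step → ℕ
#N []       = 0
#N (N ∷ w)  = suc (#N w)
#N (E ∷ w)  = #N w

#E : List Step → ℕ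
#E []       = 0
#E (N ∷ w)  = #E w
#E (E ∷ w)  = suc (#E w)

IsBallot : ∀ {k} → Vec Step k → Set
IsBallot p = All (λ q → #N q ≤ #E q) (inits (toList p))

-- Subsets of {1,…,k} are encoded as 'Subset k' (from Data.Fin.Subset):
-- the index j : Fin k stands for the natural number  toℕ j + 1.
vertex : ∀ {k} → Fin k → ℕ
vertex j = suc (toℕ j)

isN : Step → Bool
isN N = inside
isN E = outside

-- S(p) = { k+1-i : p_i = N }.  The number toℕ j + 1 lies in S(p) iff
-- p_{k-toℕ j} = N (1-indexed), i.e. the 0-indexed letter at 'opposite j'
-- (= k-1-toℕ j) is N.
S : ∀ {k} → Vec Step k → Subset k
S p = tabulate (λ j → isN (lookup p (opposite j)))

𝓑 : (k : ℕ) → Subset k → Set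
𝓑 k A = Σ (Vec Step k) (λ p → IsBallot p × S p ≡ A)

Faces : (k i : ℕ) → Set
Faces k i = Σ (Subset k) (λ A → 𝓑 k A × ∣ A ∣ ≡ i)

binomPrev : ℕ → ℕ → ℕ
binomPrev k zero    = 0
binomPrev k (suc i) = k C i

-- Reading a word backwards and recording its N's identifies words of length k with subsets of
-- {1,…,k}, the size of the subset being the number of N's.  Turning N's into E's preserves the
-- ballot property, a ballot word starts with E and has at most k/2 N's, and (EN)^⌊k/2⌋ attains
-- this bound; this gives the complex.  For the f-vector, ballot words started h steps below the
-- diagonal obey a Pascal recurrence in (k, h) obtained by splitting off the first letter, and so
-- does binom k i minus its reflected count binom k (i-h-1); at h = 0 this is binom k i - binom k (i-1).

module Submission where

open import Defs
open import Data.Bool using (Bool; true; false)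
open import Data.Empty using (⊥; ⊥-elim)
open import Data.Fin using (Fin; zero; suc; toℕ; opposite; fromℕ; inject₁)
open import Data.Fin.Properties using (toℕ-injective; opposite-involutive; opposite-prop; +↔⊎)
open import Data.Fin.Subset using (Subset; _⊆_; _∈_; _∉_; ∣_∣; ⁅_⁆; inside; outside) renaming (⊥ to ∅)
open import Data.Fin.Subset.Properties using (x≢y⇒x∉⁅y⁆; ∣⁅x⁆∣≡1; ∣⊥∣≡0)
open import Data.List using (List; []; _∷_; inits)
open import Data.List.Relation.Unary.All as All using (All; []; _∷_)
open import Data.List.Relation.Unary.All.Properties using (map⁺; map⁻)
open import Data.Nat using (ℕ; zero; suc; _+_; _*_; _≤_; _∸_; _/_; z≤n; s≤s; s≤s⁻¹)
open import Data.Nat.Combinatorics using (_C_; nCk+nC[k+1]≡[n+1]C[k+1])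
open import Data.Nat.DivMod using (m*n/n≡m; m/n*n≤m; /-monoˡ-≤; +-distrib-/-∣ˡ)
open import Data.Nat.Divisibility using (divides-refl)
open import Data.Nat.Properties
open import Algebra.Properties.CommutativeSemigroup +-commutativeSemigroup using (interchange)
open import Data.Product using (Σ; ∃; _×_; _,_)
open import Data.Sum using (_⊎_; inj₁; inj₂)
open import Data.Sum.Function.Propositional using (_⊎-↔_)
open import Data.Unit using (⊤; tt)
open import Data.Vec using (Vec; []; _∷_; lookup; tabulate; toList; replicate; _∷ʳ_)
open import Data.Vec.Properties using (lookup∘tabulate; tabulate∘lookup; tabulate-cong; []=⇒lookup; lookup⇒[]=)
open import Function using (_∘_)
open import Function.Bundles using (_↔_; _⇔_; mk↔ₛ′; mk⇔; Equivalence)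
open import Function.Properties.Inverse using (↔-trans; ↔-sym)
open import Relation.Binary.PropositionalEquality
open import Relation.Nullary using (¬_)

-- Ballot h w: the path w, started h steps below the diagonal, never crosses it.
Ballot : ℕ → List Step → Set
Ballot h       []      = ⊤
Ballot h       (E ∷ w) = Ballot (suc h) w
Ballot zero    (N ∷ w) = ⊥
Ballot (suc h) (N ∷ w) = Ballot h w

Ballot-irrelevant : ∀ h w (a b : Ballot h w) → a ≡ b
Ballot-irrelevant h       []      tt tt = refl
Ballot-irrelevant h       (E ∷ w) a  b  = Ballot-irrelevant (suc h) w a b
Ballot-irrelevant (suc h) (N ∷ w) a  b  = Ballot-irrelevant h w a b

prefixes⇔Ballot : ∀ h w → All (λ u → #N u ≤ h + #E u) (inits w) ⇔ Ballot h w
prefixes⇔Ballot h w = mk⇔ (to h w) (from h w)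
  where
  to : ∀ h w → All (λ u → #N u ≤ h + #E u) (inits w) → Ballot h w
  to h       []      _               = tt
  to h       (E ∷ w) (_ ∷ prefixes)  =
    to (suc h) w (All.map (λ {u} → subst (#N u ≤_) (+-suc h (#E u))) (map⁻ prefixes))
  to zero    (N ∷ w) (_ ∷ () ∷ _)
  to (suc h) (N ∷ w) (_ ∷ prefixes)  = to h w (All.map s≤s⁻¹ (map⁻ prefixes))

  from : ∀ h w → Ballot h w → All (λ u → #N u ≤ h + #E u) (inits w)
  from h       []      _ = z≤n ∷ []
  from h       (E ∷ w) b =
    z≤n ∷ map⁺ (All.map (λ {u} → subst (#N u ≤_) (sym (+-suc h (#E u)))) (from (suc h) w b))
  from (suc h) (N ∷ w) b = z≤n ∷ map⁺ (All.map s≤s (from h w b))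

Ballot-mono : ∀ {h h′} w → h ≤ h′ → Ballot h w → Ballot h′ w
Ballot-mono []      _         _ = tt
Ballot-mono (E ∷ w) h≤h′      b = Ballot-mono w (s≤s h≤h′) b
Ballot-mono (N ∷ w) (s≤s h≤h′) b = Ballot-mono w h≤h′ b

Ballot-few-N : ∀ h w → #N w ≤ h → Ballot h w
Ballot-few-N h       []      _   = tt
Ballot-few-N h       (E ∷ w) n≤h = Ballot-few-N (suc h) w (m≤n⇒m≤1+n n≤h)
Ballot-few-N (suc h) (N ∷ w) n≤h = Ballot-few-N h w (s≤s⁻¹ n≤h)

Ballot⇒#N≤h+#E : ∀ h w → Ballot h w → #N w ≤ h + #E w
Ballot⇒#N≤h+#E h       []      _ = z≤n
Ballot⇒#N≤h+#E h       (E ∷ w) b = subst (#N w ≤_) (sym (+-suc h (#E w))) (Ballot⇒#N≤h+#E (suc h) w b)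
Ballot⇒#N≤h+#E (suc h) (N ∷ w) b = s≤s (Ballot⇒#N≤h+#E h w b)

_⊑_ : ∀ {k} → Vec Step k → Vec Step k → Set
v ⊑ w = ∀ i → lookup v i ≡ N → lookup w i ≡ N

Ballot-⊑ : ∀ {k h} (v w : Vec Step k) → v ⊑ w → Ballot h (toList w) → Ballot h (toList v)
Ballot-⊑               []      []      _   _ = tt
Ballot-⊑               (E ∷ v) (E ∷ w) v⊑w b = Ballot-⊑ v w (v⊑w ∘ suc) b
Ballot-⊑ {h = suc h}   (E ∷ v) (N ∷ w) v⊑w b = Ballot-mono (toList v) (m≤n+m h 2) (Ballot-⊑ v w (v⊑w ∘ suc) b)
Ballot-⊑               (N ∷ v) (E ∷ w) v⊑w _ with () ← v⊑w zero refl
Ballot-⊑ {h = suc h}   (N ∷ v) (N ∷ w) v⊑w b = Ballot-⊑ v w (v⊑w ∘ suc) b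

#N+#E≡length : ∀ {k} (w : Vec Step k) → #N (toList w) + #E (toList w) ≡ k
#N+#E≡length []      = refl
#N+#E≡length (N ∷ w) = cong suc (#N+#E≡length w)
#N+#E≡length (E ∷ w) = trans (+-suc (#N (toList w)) (#E (toList w))) (cong suc (#N+#E≡length w))

m+m≤n⇒m≤n/2 : ∀ {m n} → m + m ≤ n → m ≤ n / 2
m+m≤n⇒m≤n/2 {m} {n} m+m≤n = begin
  m           ≡⟨ m*n/n≡m m 2 ⟨
  m * 2 / 2   ≤⟨ /-monoˡ-≤ 2 (subst (_≤ n) (sym m*2≡m+m) m+m≤n) ⟩
  n / 2       ∎
  where
  open ≤-Reasoning
  m*2≡m+m : m * 2 ≡ m + m
  m*2≡m+m = trans (*-comm m 2) (cong (m +_) (+-identityʳ m))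

Ballot⇒#N≤half : ∀ {k} (w : Vec Step k) → Ballot 0 (toList w) → #N (toList w) ≤ k / 2
Ballot⇒#N≤half {k} w b = m+m≤n⇒m≤n/2 (begin
  #N (toList w) + #N (toList w) ≤⟨ +-monoʳ-≤ (#N (toList w)) (Ballot⇒#N≤h+#E 0 (toList w) b) ⟩
  #N (toList w) + #E (toList w) ≡⟨ #N+#E≡length w ⟩
  k                             ∎)
  where open ≤-Reasoning

Ballot⇒first≢N : ∀ {k} (w : Vec Step (suc k)) → Ballot 0 (toList w) → lookup w zero ≢ N
Ballot⇒first≢N (E ∷ w) _ ()

first≢N∧#N≤1⇒Ballot : ∀ {k} (w : Vec Step (suc k)) → lookup w zero ≢ N → #N (toList w) ≤ 1 → Ballot 0 (toList w)
first≢N∧#N≤1⇒Ballot (E ∷ w) _       #N≤1 = Ballot-few-N 1 (toList w) #N≤1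
first≢N∧#N≤1⇒Ballot (N ∷ w) first≢N _    = ⊥-elim (first≢N refl)

alternating : ∀ k → Vec Step k
alternating zero          = []
alternating (suc zero)    = E ∷ []
alternating (suc (suc k)) = E ∷ N ∷ alternating k

alternating-Ballot : ∀ h k → Ballot h (toList (alternating k))
alternating-Ballot h zero          = tt
alternating-Ballot h (suc zero)    = tt
alternating-Ballot h (suc (suc k)) = alternating-Ballot h k

#N-alternating : ∀ k → #N (toList (alternating k)) ≡ k / 2
#N-alternating zero          = refl
#N-alternating (suc zero)    = refl
#N-alternating (suc (suc k)) = trans (cong suc (#N-alternating k)) (sym (+-distrib-/-∣ˡ k {2} (divides-refl 1)))

opposite-fromℕ : ∀ n → opposite (fromℕ n) ≡ zero
opposite-fromℕ zero    = refl
opposite-fromℕ (suc n) = cong inject₁ (opposite-fromℕ n)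

opposite-inject₁ : ∀ {n} (i : Fin n) → opposite (inject₁ i) ≡ suc (opposite i)
opposite-inject₁ zero    = refl
opposite-inject₁ (suc i) = cong inject₁ (opposite-inject₁ i)

tabulate-∷ʳ : ∀ {A : Set} n (f : Fin (suc n) → A) → tabulate f ≡ tabulate (f ∘ inject₁) ∷ʳ f (fromℕ n)
tabulate-∷ʳ zero    f = refl
tabulate-∷ʳ (suc n) f = cong (f zero ∷_) (tabulate-∷ʳ n (f ∘ suc))

∣∷ʳinside∣ : ∀ {k} (v : Subset k) → ∣ v ∷ʳ inside ∣ ≡ suc ∣ v ∣
∣∷ʳinside∣ []          = refl
∣∷ʳinside∣ (true ∷ v)  = cong suc (∣∷ʳinside∣ v)
∣∷ʳinside∣ (false ∷ v) = ∣∷ʳinside∣ v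

∣∷ʳoutside∣ : ∀ {k} (v : Subset k) → ∣ v ∷ʳ outside ∣ ≡ ∣ v ∣
∣∷ʳoutside∣ []          = refl
∣∷ʳoutside∣ (true ∷ v)  = cong suc (∣∷ʳoutside∣ v)
∣∷ʳoutside∣ (false ∷ v) = ∣∷ʳoutside∣ v

-- S p is definitionally revMap isN p.
revMap : ∀ {A B : Set} {k} → (A → B) → Vec A k → Vec B k
revMap f v = tabulate (λ i → f (lookup v (opposite i)))

revMap-inverse : ∀ {A B : Set} {k} (f : A → B) (g : B → A) → (∀ x → g (f x) ≡ x) →
                 (v : Vec A k) → revMap g (revMap f v) ≡ v
revMap-inverse f g g∘f v = trans (tabulate-cong entry) (tabulate∘lookup v)
  where
  entry : ∀ i → g (lookup (revMap f v) (opposite i)) ≡ lookup v i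
  entry i = begin
    g (lookup (revMap f v) (opposite i))     ≡⟨ cong g (lookup∘tabulate _ (opposite i)) ⟩
    g (f (lookup v (opposite (opposite i)))) ≡⟨ g∘f _ ⟩
    lookup v (opposite (opposite i))         ≡⟨ cong (lookup v) (opposite-involutive i) ⟩
    lookup v i                               ∎
    where open ≡-Reasoning

revMap-∷ : ∀ {A B : Set} {k} (f : A → B) x (v : Vec A k) → revMap f (x ∷ v) ≡ revMap f v ∷ʳ f x
revMap-∷ {k = k} f x v = begin
  revMap f (x ∷ v)                                                 ≡⟨ tabulate-∷ʳ k (λ i → f (lookup (x ∷ v) (opposite i))) ⟩
  tabulate (λ i → f (lookup (x ∷ v) (opposite (inject₁ i))))
    ∷ʳ f (lookup (x ∷ v) (opposite (fromℕ k)))                     ≡⟨ cong₂ _∷ʳ_ (tabulate-cong shift) last ⟩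
  revMap f v ∷ʳ f x                                                ∎
  where
  open ≡-Reasoning
  shift : ∀ i → f (lookup (x ∷ v) (opposite (inject₁ i))) ≡ f (lookup v (opposite i))
  shift i = cong (λ j → f (lookup (x ∷ v) j)) (opposite-inject₁ i)
  last : f (lookup (x ∷ v) (opposite (fromℕ k))) ≡ f x
  last = cong (λ j → f (lookup (x ∷ v) j)) (opposite-fromℕ k)

stepOf : Bool → Step
stepOf true  = N
stepOf false = E

stepOf-isN : ∀ x → stepOf (isN x) ≡ x
stepOf-isN N = refl
stepOf-isN E = refl

isN-stepOf : ∀ b → isN (stepOf b) ≡ b
isN-stepOf true  = refl
isN-stepOf false = refl

stepOf≡N⇔ : ∀ b → stepOf b ≡ N ⇔ b ≡ true
stepOf≡N⇔ true  = mk⇔ (λ _ → refl) (λ _ → refl)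
stepOf≡N⇔ false = mk⇔ (λ ()) (λ ())

wordOf : ∀ {k} → Subset k → Vec Step k
wordOf = revMap stepOf

S-wordOf : ∀ {k} (A : Subset k) → S (wordOf A) ≡ A
S-wordOf = revMap-inverse stepOf isN isN-stepOf

wordOf-S : ∀ {k} (p : Vec Step k) → wordOf (S p) ≡ p
wordOf-S = revMap-inverse isN stepOf stepOf-isN

∣S∣≡#N : ∀ {k} (p : Vec Step k) → ∣ S p ∣ ≡ #N (toList p)
∣S∣≡#N []      = refl
∣S∣≡#N (N ∷ p) = trans (cong ∣_∣ (revMap-∷ isN N p)) (trans (∣∷ʳinside∣ (S p)) (cong suc (∣S∣≡#N p)))
∣S∣≡#N (E ∷ p) = trans (cong ∣_∣ (revMap-∷ isN E p)) (trans (∣∷ʳoutside∣ (S p)) (∣S∣≡#N p))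

#N-wordOf : ∀ {k} (A : Subset k) → #N (toList (wordOf A)) ≡ ∣ A ∣
#N-wordOf A = trans (sym (∣S∣≡#N (wordOf A))) (cong ∣_∣ (S-wordOf A))

wordOf≡N⇔ : ∀ {k} (A : Subset k) i → lookup (wordOf A) i ≡ N ⇔ opposite i ∈ A
wordOf≡N⇔ A i = mk⇔
  (λ eq → lookup⇒[]= (opposite i) A (Equivalence.to (stepOf≡N⇔ _) (trans (sym (lookup∘tabulate _ i)) eq)))
  (λ i∈A → trans (lookup∘tabulate _ i) (Equivalence.from (stepOf≡N⇔ _) ([]=⇒lookup i∈A)))

wordOf-mono : ∀ {k} {A B : Subset k} → B ⊆ A → wordOf B ⊑ wordOf A
wordOf-mono {A = A} {B} B⊆A i =
  Equivalence.from (wordOf≡N⇔ A i) ∘ B⊆A ∘ Equivalence.to (wordOf≡N⇔ B i)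

𝓑⇔Ballot-wordOf : ∀ {k} (A : Subset k) → 𝓑 k A ⇔ Ballot 0 (toList (wordOf A))
𝓑⇔Ballot-wordOf A = mk⇔ to from
  where
  to : 𝓑 _ A → Ballot 0 (toList (wordOf A))
  to (p , ballot , refl) =
    subst (Ballot 0 ∘ toList) (sym (wordOf-S p)) (Equivalence.to (prefixes⇔Ballot 0 (toList p)) ballot)
  from : Ballot 0 (toList (wordOf A)) → 𝓑 _ A
  from b = wordOf A , Equivalence.from (prefixes⇔Ballot 0 _) b , S-wordOf A

vertex≤k⇔opposite≢0 : ∀ {k} (j : Fin (suc k)) → vertex j ≤ k ⇔ opposite j ≢ zero
vertex≤k⇔opposite≢0 {k} j = mk⇔
  (λ j<k opp≡0 → n>0⇒n≢0 (m<n⇒0<n∸m j<k) (trans (sym (opposite-prop j)) (cong toℕ opp≡0)))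
  (λ opp≢0 → m∸n≢0⇒n<m (λ k∸j≡0 → opp≢0 (toℕ-injective (trans (opposite-prop j) k∸j≡0))))

𝓑-empty : ∀ k → 𝓑 k ∅
𝓑-empty k = Equivalence.from (𝓑⇔Ballot-wordOf {k} ∅)
  (Ballot-few-N 0 (toList (wordOf {k} ∅)) (≤-reflexive (trans (#N-wordOf {k} ∅) (∣⊥∣≡0 k))))

𝓑-downward-closed : ∀ {k} (A B : Subset k) → B ⊆ A → 𝓑 k A → 𝓑 k B
𝓑-downward-closed A B B⊆A 𝓑A = Equivalence.from (𝓑⇔Ballot-wordOf B)
  (Ballot-⊑ (wordOf B) (wordOf A) (wordOf-mono B⊆A) (Equivalence.to (𝓑⇔Ballot-wordOf A) 𝓑A))

-- The vertex k would come from an N as first letter.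
𝓑-vertex-bound : ∀ {k} (A : Subset k) (j : Fin k) → 𝓑 k A → j ∈ A → vertex j ≤ k ∸ 1
𝓑-vertex-bound {suc k} A j 𝓑A j∈A = Equivalence.from (vertex≤k⇔opposite≢0 j) λ opp≡0 →
  Ballot⇒first≢N (wordOf A) (Equivalence.to (𝓑⇔Ballot-wordOf A) 𝓑A)
    (subst (λ i → lookup (wordOf A) i ≡ N) opp≡0 wordOf≡N)
  where
  wordOf≡N : lookup (wordOf A) (opposite j) ≡ N
  wordOf≡N = Equivalence.from (wordOf≡N⇔ A (opposite j)) (subst (_∈ A) (sym (opposite-involutive j)) j∈A)

𝓑-singleton : ∀ {k} (j : Fin k) → vertex j ≤ k ∸ 1 → 𝓑 k ⁅ j ⁆
𝓑-singleton {suc k} j j≤k = Equivalence.from (𝓑⇔Ballot-wordOf ⁅ j ⁆)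
  (first≢N∧#N≤1⇒Ballot (wordOf ⁅ j ⁆) (first∉⁅j⁆ ∘ Equivalence.to (wordOf≡N⇔ ⁅ j ⁆ zero))
    (≤-reflexive (trans (#N-wordOf ⁅ j ⁆) (∣⁅x⁆∣≡1 j))))
  where
  first∉⁅j⁆ : opposite zero ∉ ⁅ j ⁆
  first∉⁅j⁆ = x≢y⇒x∉⁅y⁆ λ first≡j →
    Equivalence.to (vertex≤k⇔opposite≢0 j) j≤k (trans (cong opposite (sym first≡j)) (opposite-involutive zero))

𝓑-card≤half : ∀ {k} (A : Subset k) → 𝓑 k A → ∣ A ∣ ≤ k / 2
𝓑-card≤half A 𝓑A = subst (_≤ _) (#N-wordOf A)
  (Ballot⇒#N≤half (wordOf A) (Equivalence.to (𝓑⇔Ballot-wordOf A) 𝓑A))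

𝓑-card-half-attained : ∀ k → ∃ λ (A : Subset k) → 𝓑 k A × ∣ A ∣ ≡ k / 2
𝓑-card-half-attained k =
  S (alternating k) ,
  (alternating k , Equivalence.from (prefixes⇔Ballot 0 _) (alternating-Ballot 0 k) , refl) ,
  trans (∣S∣≡#N (alternating k)) (#N-alternating k)

BallotWords : ℕ → ℕ → ℕ → Set
BallotWords k h i = Σ (Vec Step k) λ w → Ballot h (toList w) × #N (toList w) ≡ i

NTails : ℕ → ℕ → ℕ → Set
NTails k h i = Σ (Vec Step k) λ w → Ballot h (N ∷ toList w) × suc (#N (toList w)) ≡ i

BallotWords-∷ : ∀ k h i → BallotWords (suc k) h i ↔ (BallotWords k (suc h) i ⊎ NTails k h i)
BallotWords-∷ k h i = mk↔ₛ′ to from to∘from from∘to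
  where
  to : BallotWords (suc k) h i → BallotWords k (suc h) i ⊎ NTails k h i
  to (E ∷ w , b , e) = inj₁ (w , b , e)
  to (N ∷ w , b , e) = inj₂ (w , b , e)
  from : BallotWords k (suc h) i ⊎ NTails k h i → BallotWords (suc k) h i
  from (inj₁ (w , b , e)) = E ∷ w , b , e
  from (inj₂ (w , b , e)) = N ∷ w , b , e
  to∘from : ∀ x → to (from x) ≡ x
  to∘from (inj₁ _) = refl
  to∘from (inj₂ _) = refl
  from∘to : ∀ x → from (to x) ≡ x
  from∘to (E ∷ _ , _) = refl
  from∘to (N ∷ _ , _) = refl

NTails↔BallotWords : ∀ k h i → NTails k (suc h) (suc i) ↔ BallotWords k h i
NTails↔BallotWords k h i = mk↔ₛ′
  (λ (w , b , e) → w , b , suc-injective e)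
  (λ (w , b , e) → w , b , cong suc e)
  (λ (w , b , e) → cong (λ e → w , b , e) (≡-irrelevant _ _))
  (λ (w , b , e) → cong (λ e → w , b , e) (≡-irrelevant _ _))

¬⇒↔Fin0 : ∀ {A : Set} → ¬ A → A ↔ Fin 0
¬⇒↔Fin0 ¬a = mk↔ₛ′ (⊥-elim ∘ ¬a) (λ ()) (λ ()) (⊥-elim ∘ ¬a)

ballotCount : ℕ → ℕ → ℕ → ℕ
nTailCount  : ℕ → ℕ → ℕ → ℕ
ballotCount zero    h zero    = 1
ballotCount zero    h (suc i) = 0
ballotCount (suc k) h i       = ballotCount k (suc h) i + nTailCount k h i
nTailCount  k (suc h) (suc i) = ballotCount k h i
nTailCount  k zero    i       = 0
nTailCount  k (suc h) zero    = 0

BallotWords↔Fin : ∀ k h i → BallotWords k h i ↔ Fin (ballotCount k h i)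
NTails↔Fin      : ∀ k h i → NTails k h i ↔ Fin (nTailCount k h i)
BallotWords↔Fin zero h zero = mk↔ₛ′ (λ _ → zero) (λ _ → [] , tt , refl)
  (λ { zero → refl })
  (λ { ([] , tt , e) → cong (λ e → [] , tt , e) (≡-irrelevant _ _) })
BallotWords↔Fin zero h (suc i) = ¬⇒↔Fin0 λ { ([] , _ , ()) }
BallotWords↔Fin (suc k) h i =
  ↔-trans (BallotWords-∷ k h i) (↔-trans (BallotWords↔Fin k (suc h) i ⊎-↔ NTails↔Fin k h i) (↔-sym +↔⊎))
NTails↔Fin k (suc h) (suc i) = ↔-trans (NTails↔BallotWords k h i) (BallotWords↔Fin k h i)
NTails↔Fin k zero    i       = ¬⇒↔Fin0 λ ()
NTails↔Fin k (suc h) zero    = ¬⇒↔Fin0 λ ()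

Faces↔BallotWords : ∀ k i → Faces k i ↔ BallotWords k 0 i
Faces↔BallotWords k i = mk↔ₛ′ to from to∘from from∘to
  where
  ballot⇔ : ∀ (p : Vec Step k) → IsBallot p ⇔ Ballot 0 (toList p)
  ballot⇔ p = prefixes⇔Ballot 0 (toList p)
  to : Faces k i → BallotWords k 0 i
  to (A , (p , ballot , S≡A) , ∣A∣≡i) =
    p , Equivalence.to (ballot⇔ p) ballot , trans (sym (∣S∣≡#N p)) (trans (cong ∣_∣ S≡A) ∣A∣≡i)
  from : BallotWords k 0 i → Faces k i
  from (p , b , #N≡i) = S p , (p , Equivalence.from (ballot⇔ p) b , refl) , trans (∣S∣≡#N p) #N≡i
  to∘from : ∀ x → to (from x) ≡ x
  to∘from (p , b , e) =
    cong₂ (λ b e → p , b , e) (Ballot-irrelevant 0 (toList p) _ _) (≡-irrelevant _ _)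
  from∘to : ∀ x → from (to x) ≡ x
  from∘to (_ , (p , ballot , refl) , e) =
    cong₂ (λ ballot e → S p , (p , ballot , refl) , e) (All.irrelevant ≤-irrelevant _ _) (≡-irrelevant _ _)

binomPrev-pascal : ∀ k i → suc k C i ≡ binomPrev k i + k C i
binomPrev-pascal k zero    = refl
binomPrev-pascal k (suc i) = sym (nCk+nC[k+1]≡[n+1]C[k+1] k i)

-- reflected k h i = k C (i-h-1), zero when i ≤ h: by André's reflection principle, the number of
-- words of length k with i N's that cross the diagonal when started h steps below it, if 2i ≤ h+k+1.
reflected : ℕ → ℕ → ℕ → ℕ
reflected k h       zero    = 0
reflected k zero    (suc i) = k C i
reflected k (suc h) (suc i) = reflected k h i

reflected-0 : ∀ k i → reflected k 0 i ≡ binomPrev k i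
reflected-0 k zero    = refl
reflected-0 k (suc i) = refl

reflected-pascal : ∀ k h i → reflected (suc k) h i ≡ reflected k (suc h) i + reflected k h i
reflected-pascal k h       zero    = refl
reflected-pascal k zero    (suc i) = trans (binomPrev-pascal k i) (cong (_+ k C i) (sym (reflected-0 k i)))
reflected-pascal k (suc h) (suc i) = reflected-pascal k h i

reflected-vanishes : ∀ k h i → i ≤ h → reflected k h i ≡ 0
reflected-vanishes k h       zero    _         = refl
reflected-vanishes k (suc h) (suc i) (s≤s i≤h) = reflected-vanishes k h i i≤h

ballotCount+reflected : ∀ k h i → i * 2 ≤ suc (h + k) → ballotCount k h i + reflected k h i ≡ k C i
ballotCount+reflected zero    h zero    _                 = refl
ballotCount+reflected zero    h (suc i) (s≤s 1+i*2≤h+0) =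
  reflected-vanishes 0 h (suc i) (≤-trans (s≤s (m≤m*n i 2)) (subst (_ ≤_) (+-identityʳ h) 1+i*2≤h+0))
ballotCount+reflected (suc k) h i       i*2≤1+h+[1+k] = begin
  (ballotCount k (suc h) i + nTailCount k h i) + reflected (suc k) h i
    ≡⟨ cong (ballotCount k (suc h) i + nTailCount k h i +_) (reflected-pascal k h i) ⟩
  (ballotCount k (suc h) i + nTailCount k h i) + (reflected k (suc h) i + reflected k h i)
    ≡⟨ interchange (ballotCount k (suc h) i) _ _ _ ⟩
  (ballotCount k (suc h) i + reflected k (suc h) i) + (nTailCount k h i + reflected k h i)
    ≡⟨ cong₂ _+_ (ballotCount+reflected k (suc h) i i*2≤2+h+k) (nTailCount+reflected h i i*2≤2+h+k) ⟩
  k C i + binomPrev k i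
    ≡⟨ +-comm (k C i) _ ⟩
  binomPrev k i + k C i
    ≡⟨ binomPrev-pascal k i ⟨
  suc k C i ∎
  where
  open ≡-Reasoning
  i*2≤2+h+k : i * 2 ≤ suc (suc h + k)
  i*2≤2+h+k = subst (λ n → i * 2 ≤ suc n) (+-suc h k) i*2≤1+h+[1+k]
  nTailCount+reflected : ∀ h i → i * 2 ≤ suc (suc h + k) → nTailCount k h i + reflected k h i ≡ binomPrev k i
  nTailCount+reflected zero    i       _                  = reflected-0 k i
  nTailCount+reflected (suc h) zero    _                  = refl
  nTailCount+reflected (suc h) (suc i) (s≤s (s≤s bound)) = ballotCount+reflected k h i bound

proposition6p4 : (k : ℕ) →
      𝓑 k (replicate k outside)
    × (∀ (A B : Subset k) → B ⊆ A → 𝓑 k A → 𝓑 k B)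
    × (∀ (A : Subset k) (j : Fin k) → 𝓑 k A → j ∈ A → vertex j ≤ k ∸ 1)
    × (∀ (j : Fin k) → vertex j ≤ k ∸ 1 → 𝓑 k ⁅ j ⁆)
    × (∀ (A : Subset k) → 𝓑 k A → ∣ A ∣ ≤ k / 2)
    × (∃ λ (A : Subset k) → 𝓑 k A × ∣ A ∣ ≡ k / 2)
    × (∀ (i : ℕ) → i ≤ k / 2 →
         ∃ λ (f : ℕ) → (Faces k i ↔ Fin f) × f + binomPrev k i ≡ k C i)
proposition6p4 k =
  𝓑-empty k , 𝓑-downward-closed , 𝓑-vertex-bound , 𝓑-singleton , 𝓑-card≤half , 𝓑-card-half-attained k ,
  λ i i≤k/2 →
    ballotCount k 0 i ,
    ↔-trans (Faces↔BallotWords k i) (BallotWords↔Fin k 0 i) ,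
    (begin
      ballotCount k 0 i + binomPrev k i    ≡⟨ cong (ballotCount k 0 i +_) (reflected-0 k i) ⟨
      ballotCount k 0 i + reflected k 0 i  ≡⟨ ballotCount+reflected k 0 i (m≤n⇒m≤1+n (≤-trans (*-monoˡ-≤ 2 i≤k/2) (m/n*n≤m k 2))) ⟩
      k C i                                ∎)
  where open ≡-Reasoning
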